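{- Let $G$ be a connected graph, let $g$ be an IC-coloring of $G$, and let $m \geq 1$ be an integer. Then there exists an IC-coloring $f$ of the join $O_m \vee G$ such that $f(O_m \vee G) = 2^m g(G) + 1$.
   Context: All graphs are finite and simple. For a connected graph $G$, a coloring of $G$ is a function $f: V(G) \to \mathbb{N}$ (positive integers). For a subgraph $H$ of $G$, write $f(H) = \sum_{v \in V(H)} f(v)$. A coloring $f$ is an IC-coloring of $G$ if for every integer $k \in \{1, 2, \dots, f(G)\}$ there is an induced connected subgraph $H$ of $G$ with $f(H) = k$. $O_m$ denotes the graph with $m$ vertices and no edges. The join $H_0 \vee H_1$ of disjoint graphs has vertex set $V(H_0) \cup V(H_1)$ and edge set $E(H_0) \cup E(H_1) \cup \{uv : u \in V(H_0), v \in V(H_1)\}$. -}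

module Defs where

open import Data.Nat using (ℕ; zero; suc; _+_; _*_; _^_; _≤_)
open import Data.Bool using (Bool; true; false; if_then_else_)
open import Data.Fin using (Fin; splitAt)
open import Data.Fin.Subset using (Subset; _∈_; ⊤)
open import Data.Vec using (tabulate; lookup)
import Data.Vec as Vec
open import Data.Sum using (_⊎_; inj₁; inj₂)
open import Data.Product using (Σ; ∃; _×_; _,_)
open import Relation.Binary.PropositionalEquality using (_≡_; refl)

record Graph : Set where
  field
    n      : ℕ
    adj    : Fin n → Fin n → Bool
    sym    : ∀ u v → adj u v ≡ adj v u
    irrefl : ∀ u → adj u u ≡ false
open Graph public

data WalkIn (G : Graph) (S : Subset (n G)) : Fin (n G) → Fin (n G) → Set where
  here : ∀ {u} → u ∈ S → WalkIn G S u u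
  step : ∀ {u w v} → u ∈ S → adj G u w ≡ true → WalkIn G S w v → WalkIn G S u v

ConnectedSet : (G : Graph) → Subset (n G) → Set
ConnectedSet G S = (∃ λ u → u ∈ S) × (∀ u v → u ∈ S → v ∈ S → WalkIn G S u v)

Connected : Graph → Set
Connected G = ConnectedSet G ⊤

-- A coloring: a function into ℕ (positivity is required separately).
Coloring : Graph → Set
Coloring G = Fin (n G) → ℕ

weight : (G : Graph) → Coloring G → Subset (n G) → ℕ
weight G f S = Vec.sum (tabulate λ i → if lookup S i then f i else 0)

total : (G : Graph) → Coloring G → ℕ
total G f = weight G f ⊤

IsIC : (G : Graph) → Coloring G → Set
IsIC G f = (∀ v → 1 ≤ f v)
         × (∀ k → 1 ≤ k → k ≤ total G f → ∃ λ S → ConnectedSet G S × weight G f S ≡ k)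

-- The join O_m ∨ G: vertices Fin (m + n G); the first m vertices form O_m.
joinAdj : (m : ℕ) (G : Graph) → Fin (m + n G) → Fin (m + n G) → Bool
joinAdj m G u v with splitAt m u | splitAt m v
... | inj₁ _ | inj₁ _ = false
... | inj₁ _ | inj₂ _ = true
... | inj₂ _ | inj₁ _ = true
... | inj₂ a | inj₂ b = adj G a b

joinAdj-sym : ∀ m G u v → joinAdj m G u v ≡ joinAdj m G v u
joinAdj-sym m G u v with splitAt m u | splitAt m v
... | inj₁ _ | inj₁ _ = refl
... | inj₁ _ | inj₂ _ = refl
... | inj₂ _ | inj₁ _ = refl
... | inj₂ a | inj₂ b = sym G a b

joinAdj-irrefl : ∀ m G u → joinAdj m G u u ≡ false
joinAdj-irrefl m G u with splitAt m u
... | inj₁ _ = refl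
... | inj₂ a = irrefl G a

join : ℕ → Graph → Graph
join m G = record
  { n = m + n G ; adj = joinAdj m G ; sym = joinAdj-sym m G ; irrefl = joinAdj-irrefl m G }

-- Give the m new vertices the weights  2^{m-1} T + 1, T, 2T, 4T, …, 2^{m-2} T,  where T = g(G).
-- Any k ≤ 2^{m-1} T is  c T + j  with  c < 2^{m-1}  and  1 ≤ j ≤ T: the binary digits of c pick
-- new vertices of total weight c T, and j is the weight of a connected S ⊆ G since g is an
-- IC-coloring. Adding the heavy vertex 2^{m-1} T + 1 covers the upper half of the range, and it
-- is the weight of its own singleton. Each such vertex set is connected in the join because a
-- nonempty connected S ⊆ G is adjacent to every new vertex.
module Submission where

open import Defs hiding (sym)
open import Data.Nat using (ℕ; zero; suc; _+_; _*_; _^_; _∸_; _≤_; _<_; z≤n; s≤s; _≤?_)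
open import Data.Nat.Properties
open import Data.Nat.Tactic.RingSolver using (solve-∀)
open import Data.Bool using (true; false; if_then_else_)
open import Data.Fin using (Fin; splitAt; _↑ˡ_; _↑ʳ_; toℕ) renaming (zero to fzero; suc to fsuc)
open import Data.Fin.Subset using (Subset; _∈_; ⊤; ⊥; ⁅_⁆)
open import Data.Fin.Subset.Properties using (x∈⁅x⁆; x∈⁅y⁆⇒x≡y)
open import Data.Fin.Properties using (splitAt-↑ˡ; splitAt-↑ʳ)
open import Data.Vec using ([]; _∷_; _++_; tabulate; lookup; here; there)
import Data.Vec as Vec
open import Data.Vec.Properties using (tabulate-cong)
open import Data.Sum using (_⊎_; inj₁; inj₂; [_,_]′)
open import Data.Product using (∃; ∃₂; _×_; _,_; proj₁; proj₂)
open import Relation.Binary.PropositionalEquality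
  using (_≡_; refl; sym; trans; cong; cong₂; module ≡-Reasoning)
open import Relation.Binary.Definitions using (tri<; tri≈; tri>)
open import Relation.Nullary using (yes; no)

sumOver : ∀ {n} → Subset n → (Fin n → ℕ) → ℕ
sumOver S h = Vec.sum (tabulate λ i → if lookup S i then h i else 0)

sumOver-cong : ∀ {n} (S : Subset n) {h k : Fin n → ℕ} → (∀ i → h i ≡ k i) → sumOver S h ≡ sumOver S k
sumOver-cong S h≗k = cong Vec.sum (tabulate-cong λ i → cong (if lookup S i then_else 0) (h≗k i))

sumOver-++ : ∀ {m n} (Sa : Subset m) (Sb : Subset n) (h : Fin (m + n) → ℕ) →
  sumOver (Sa ++ Sb) h ≡ sumOver Sa (λ i → h (i ↑ˡ n)) + sumOver Sb (λ j → h (m ↑ʳ j))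
sumOver-++ []       Sb h = refl
sumOver-++ (b ∷ Sa) Sb h =
  trans (cong ((if b then h fzero else 0) +_) (sumOver-++ Sa Sb (λ i → h (fsuc i))))
        (sym (+-assoc (if b then h fzero else 0) _ _))

sumOver-⊥ : ∀ {n} (h : Fin n → ℕ) → sumOver ⊥ h ≡ 0
sumOver-⊥ {zero}  h = refl
sumOver-⊥ {suc n} h = sumOver-⊥ (λ i → h (fsuc i))

sumOver-⁅⁆ : ∀ {n} (i : Fin n) (h : Fin n → ℕ) → sumOver ⁅ i ⁆ h ≡ h i
sumOver-⁅⁆ fzero    h = trans (cong (h fzero +_) (sumOver-⊥ (λ i → h (fsuc i)))) (+-identityʳ (h fzero))
sumOver-⁅⁆ (fsuc i) h = sumOver-⁅⁆ i (λ j → h (fsuc j))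

∈⇒≤sumOver : ∀ {n} {S : Subset n} {i} (h : Fin n → ℕ) → i ∈ S → h i ≤ sumOver S h
∈⇒≤sumOver h here                  = m≤m+n (h fzero) _
∈⇒≤sumOver {S = b ∷ S} h (there i∈S) =
  ≤-trans (∈⇒≤sumOver (λ j → h (fsuc j)) i∈S) (m≤n+m _ (if b then h fzero else 0))

⊤-++ : ∀ m n → ⊤ {m + n} ≡ ⊤ {m} ++ ⊤ {n}
⊤-++ zero    n = refl
⊤-++ (suc m) n = cong (true ∷_) (⊤-++ m n)

binaryWeights : ∀ {p} → ℕ → Fin p → ℕ
binaryWeights w i = 2 ^ toℕ i * w

binaryWeights-suc : ∀ {p} w (i : Fin p) → binaryWeights w (fsuc i) ≡ binaryWeights (2 * w) i
binaryWeights-suc w i = lemma (2 ^ toℕ i) w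
  where
  lemma : ∀ x w → 2 * x * w ≡ x * (2 * w)
  lemma = solve-∀

even-or-odd : ∀ c → ∃ λ q → c ≡ 2 * q ⊎ c ≡ 1 + 2 * q
even-or-odd zero = 0 , inj₁ refl
even-or-odd (suc zero) = 0 , inj₂ refl
even-or-odd (suc (suc c)) with even-or-odd c
... | q , inj₁ refl = suc q , inj₁ (cong suc (sym (+-suc q (q + 0))))
... | q , inj₂ refl = suc q , inj₂ (cong (2 +_) (sym (+-suc q (q + 0))))

sumOver-binaryWeights : ∀ p w c → c < 2 ^ p → ∃ λ (S : Subset p) → sumOver S (binaryWeights w) ≡ c * w
sumOver-binaryWeights zero    w zero    _          = [] , refl
sumOver-binaryWeights zero    w (suc c) (s≤s ())
sumOver-binaryWeights (suc p) w c c<2^[1+p] with even-or-odd c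
... | q , inj₁ refl with sumOver-binaryWeights p (2 * w) q (*-cancelˡ-< 2 q (2 ^ p) c<2^[1+p])
...   | S , sum≡ = false ∷ S , trans (sumOver-cong S (binaryWeights-suc w)) (trans sum≡ (lemma q w))
  where
  lemma : ∀ q w → q * (2 * w) ≡ 2 * q * w
  lemma = solve-∀
sumOver-binaryWeights (suc p) w c c<2^[1+p] | q , inj₂ refl
  with sumOver-binaryWeights p (2 * w) q (*-cancelˡ-< 2 q (2 ^ p) (≤-<-trans (n≤1+n _) c<2^[1+p]))
... | S , sum≡ =
  true ∷ S , trans (cong (1 * w +_) (trans (sumOver-cong S (binaryWeights-suc w)) sum≡)) (lemma q w)
  where
  lemma : ∀ q w → 1 * w + q * (2 * w) ≡ (1 + 2 * q) * w
  lemma = solve-∀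

sumOver-⊤-binaryWeights : ∀ p w → sumOver ⊤ (binaryWeights {p} w) + w ≡ 2 ^ p * w
sumOver-⊤-binaryWeights zero    w = sym (+-identityʳ w)
sumOver-⊤-binaryWeights (suc p) w = begin
  1 * w + sumOver (⊤ {p}) (λ i → binaryWeights w (fsuc i)) + w
    ≡⟨ cong (λ s → 1 * w + s + w) (sumOver-cong (⊤ {p}) (binaryWeights-suc w)) ⟩
  1 * w + sumOver (⊤ {p}) (binaryWeights (2 * w)) + w  ≡⟨ lemma w _ ⟩
  sumOver (⊤ {p}) (binaryWeights (2 * w)) + 2 * w      ≡⟨ sumOver-⊤-binaryWeights p (2 * w) ⟩
  2 ^ p * (2 * w)                                ≡⟨ sym (*-assoc (2 ^ p) 2 w) ⟩
  2 ^ p * 2 * w                                  ≡⟨ cong (_* w) (*-comm (2 ^ p) 2) ⟩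
  2 ^ suc p * w                                  ∎
  where
  open ≡-Reasoning
  lemma : ∀ w s → 1 * w + s + w ≡ s + 2 * w
  lemma = solve-∀

split-into-blocks : ∀ N T k → 1 ≤ k → k ≤ N * T → ∃₂ λ c j → c < N × 1 ≤ j × j ≤ T × k ≡ c * T + j
split-into-blocks zero    T k 1≤k k≤0 with ≤-trans 1≤k k≤0
... | ()
split-into-blocks (suc N) T k 1≤k k≤[1+N]T with k ≤? T
... | yes k≤T = 0 , k , s≤s z≤n , 1≤k , k≤T , refl
... | no  k≰T with split-into-blocks N T (k ∸ T) (m<n⇒0<n∸m (≰⇒> k≰T))
                     (≤-trans (∸-monoˡ-≤ T k≤[1+N]T) (≤-reflexive (m+n∸m≡n T (N * T))))
...   | c , j , c<N , 1≤j , j≤T , k∸T≡ = suc c , j , s≤s c<N , 1≤j , j≤T , (begin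
  k                 ≡⟨ sym (m+[n∸m]≡n (<⇒≤ (≰⇒> k≰T))) ⟩
  T + (k ∸ T)       ≡⟨ cong (T +_) k∸T≡ ⟩
  T + (c * T + j)   ≡⟨ sym (+-assoc T (c * T) j) ⟩
  suc c * T + j     ∎)
  where open ≡-Reasoning

connected-⁅⁆ : ∀ (G : Graph) u → ConnectedSet G ⁅ u ⁆
connected-⁅⁆ G u = (u , x∈⁅x⁆ u) , walk
  where
  walk : ∀ v w → v ∈ ⁅ u ⁆ → w ∈ ⁅ u ⁆ → WalkIn G ⁅ u ⁆ v w
  walk v w v∈ w∈ with x∈⁅y⁆⇒x≡y u v∈ | x∈⁅y⁆⇒x≡y u w∈
  ... | refl | refl = here v∈

total-positive : ∀ (G : Graph) (g : Coloring G) → Connected G → (∀ v → 1 ≤ g v) → 1 ≤ total G g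
total-positive G g ((u , u∈⊤) , _) g-pos = ≤-trans (g-pos u) (∈⇒≤sumOver g u∈⊤)

data SplitView (m n : ℕ) : Fin (m + n) → Set where
  left  : (i : Fin m) → SplitView m n (i ↑ˡ n)
  right : (j : Fin n) → SplitView m n (m ↑ʳ j)

splitView : ∀ m n (u : Fin (m + n)) → SplitView m n u
splitView zero    n u        = right u
splitView (suc m) n fzero    = left fzero
splitView (suc m) n (fsuc u) with splitView m n u
... | left i  = left (fsuc i)
... | right j = right j

∈-++⁺ʳ : ∀ {m n} (Sa : Subset m) {Sb : Subset n} {j} → j ∈ Sb → (m ↑ʳ j) ∈ (Sa ++ Sb)
∈-++⁺ʳ []       j∈Sb = j∈Sb
∈-++⁺ʳ (_ ∷ Sa) j∈Sb = there (∈-++⁺ʳ Sa j∈Sb)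

∈-++⁻ʳ : ∀ {m n} (Sa : Subset m) {Sb : Subset n} {j} → (m ↑ʳ j) ∈ (Sa ++ Sb) → j ∈ Sb
∈-++⁻ʳ []       j∈ = j∈
∈-++⁻ʳ (_ ∷ Sa) (there j∈) = ∈-++⁻ʳ Sa j∈

module Join (G : Graph) (m : ℕ) where

  joinColoring : (Fin m → ℕ) → Coloring G → Coloring (join m G)
  joinColoring a g u = [ a , g ]′ (splitAt m u)

  weight-join : ∀ a g (Sa : Subset m) (Sg : Subset (n G)) →
    weight (join m G) (joinColoring a g) (Sa ++ Sg) ≡ sumOver Sa a + weight G g Sg
  weight-join a g Sa Sg = trans (sumOver-++ Sa Sg (joinColoring a g))
    (cong₂ _+_ (sumOver-cong Sa λ i → cong [ a , g ]′ (splitAt-↑ˡ m i (n G)))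
               (sumOver-cong Sg λ j → cong [ a , g ]′ (splitAt-↑ʳ m (n G) j)))

  adj-old-old : ∀ a b → adj (join m G) (m ↑ʳ a) (m ↑ʳ b) ≡ adj G a b
  adj-old-old a b rewrite splitAt-↑ʳ m (n G) a | splitAt-↑ʳ m (n G) b = refl

  adj-new-old : ∀ i b → adj (join m G) (i ↑ˡ n G) (m ↑ʳ b) ≡ true
  adj-new-old i b rewrite splitAt-↑ˡ m i (n G) | splitAt-↑ʳ m (n G) b = refl

  adj-old-new : ∀ b i → adj (join m G) (m ↑ʳ b) (i ↑ˡ n G) ≡ true
  adj-old-new b i rewrite splitAt-↑ˡ m i (n G) | splitAt-↑ʳ m (n G) b = refl

  walk-old : ∀ Sa {Sg a b} → WalkIn G Sg a b → WalkIn (join m G) (Sa ++ Sg) (m ↑ʳ a) (m ↑ʳ b)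
  walk-old Sa (here a∈) = here (∈-++⁺ʳ Sa a∈)
  walk-old Sa (step {u} {w} u∈ uw w⇝b) =
    step (∈-++⁺ʳ Sa u∈) (trans (adj-old-old u w) uw) (walk-old Sa w⇝b)

  connected-join : ∀ Sa {Sg} → ConnectedSet G Sg → ConnectedSet (join m G) (Sa ++ Sg)
  connected-join Sa {Sg} ((w , w∈) , walks) = (m ↑ʳ w , ∈-++⁺ʳ Sa w∈) , walk
    where
    walk : ∀ u v → u ∈ (Sa ++ Sg) → v ∈ (Sa ++ Sg) → WalkIn (join m G) (Sa ++ Sg) u v
    walk u v u∈ v∈ with splitView m (n G) u | splitView m (n G) v
    ... | left i  | left i′ = step u∈ (adj-new-old i w) (step (∈-++⁺ʳ Sa w∈) (adj-old-new w i′) (here v∈))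
    ... | left i  | right b = step u∈ (adj-new-old i w) (walk-old Sa (walks w b w∈ (∈-++⁻ʳ Sa v∈)))
    ... | right a | left i′ = step u∈ (adj-old-new a i′) (here v∈)
    ... | right a | right b = walk-old Sa (walks a b (∈-++⁻ʳ Sa u∈) (∈-++⁻ʳ Sa v∈))

module Construction (G : Graph) (g : Coloring G) (g-IC : IsIC G g) (p : ℕ) where

  open Join G (suc p)

  T = total G g
  X = 2 ^ p * T

  newColors : Fin (suc p) → ℕ
  newColors fzero    = 1 + X
  newColors (fsuc i) = binaryWeights T i

  f : Coloring (join (suc p) G)
  f = joinColoring newColors g

  Reaches : ℕ → Set
  Reaches k = ∃ λ S → ConnectedSet (join (suc p) G) S × weight (join (suc p) G) f S ≡ k

  f-positive : 1 ≤ T → ∀ v → 1 ≤ f v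
  f-positive 1≤T v with splitView (suc p) (n G) v
  ... | left fzero = s≤s z≤n
  ... | left (fsuc i) rewrite splitAt-↑ˡ (suc p) (fsuc i) (n G) =
    *-mono-≤ {1} {2 ^ toℕ i} (m^n>0 2 (toℕ i)) 1≤T
  ... | right j rewrite splitAt-↑ʳ (suc p) (n G) j = proj₁ g-IC j

  total-f : total (join (suc p) G) f ≡ (1 + X) + X
  total-f = begin
    sumOver ⊤ f                                        ≡⟨ cong (λ S → sumOver S f) (⊤-++ (suc p) (n G)) ⟩
    sumOver (⊤ {suc p} ++ ⊤ {n G}) f                   ≡⟨ weight-join newColors g ⊤ ⊤ ⟩
    (1 + X) + sumOver (⊤ {p}) (binaryWeights T) + T    ≡⟨ +-assoc (1 + X) _ T ⟩
    (1 + X) + (sumOver (⊤ {p}) (binaryWeights T) + T)  ≡⟨ cong ((1 + X) +_) (sumOver-⊤-binaryWeights p T) ⟩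
    (1 + X) + X                                        ∎
    where open ≡-Reasoning

  reach-above : ∀ b k → 1 ≤ k → k ≤ X → Reaches ((if b then 1 + X else 0) + k)
  reach-above b k 1≤k k≤X with split-into-blocks (2 ^ p) T k 1≤k k≤X
  ... | c , j , c<2^p , 1≤j , j≤T , k≡ with sumOver-binaryWeights p T c c<2^p | proj₂ g-IC j 1≤j j≤T
  ...   | Sb , Sb-sum | Sg , Sg-conn , Sg-sum = (b ∷ Sb) ++ Sg , connected-join (b ∷ Sb) Sg-conn , (begin
    weight (join (suc p) G) f ((b ∷ Sb) ++ Sg)   ≡⟨ weight-join newColors g (b ∷ Sb) Sg ⟩
    h + sumOver Sb (binaryWeights T) + T′         ≡⟨ +-assoc h _ T′ ⟩
    h + (sumOver Sb (binaryWeights T) + T′)       ≡⟨ cong (h +_) (cong₂ _+_ Sb-sum Sg-sum) ⟩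
    h + (c * T + j)                               ≡⟨ cong (h +_) (sym k≡) ⟩
    h + k                                         ∎)
    where
    open ≡-Reasoning
    h  = if b then 1 + X else 0
    T′ = weight G g Sg

  reaches : ∀ k → 1 ≤ k → k ≤ (1 + X) + X → Reaches k
  reaches k 1≤k k≤total with <-cmp k (1 + X)
  ... | tri< k<1+X _ _ = reach-above false k 1≤k (≤-pred k<1+X)
  ... | tri≈ _ refl _  = ⁅ fzero ⁆ , connected-⁅⁆ (join (suc p) G) fzero , sumOver-⁅⁆ fzero f
  ... | tri> _ _ 1+X<k with reach-above true (k ∸ (1 + X)) (m<n⇒0<n∸m 1+X<k)
                              (≤-trans (∸-monoˡ-≤ (1 + X) k≤total) (≤-reflexive (m+n∸m≡n (1 + X) X)))
  ...   | S , S-conn , S-sum = S , S-conn , trans S-sum (m+[n∸m]≡n (<⇒≤ 1+X<k))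

proposition3p1 : (G : Graph) → Connected G → (g : Coloring G) → IsIC G g →
    (m : ℕ) → 1 ≤ m →
    ∃ λ (f : Coloring (join m G)) → IsIC (join m G) f × total (join m G) f ≡ 2 ^ m * total G g + 1
proposition3p1 G G-conn g g-IC@(g-pos , _) (suc p) _ =
  f , (f-positive 1≤T , λ k 1≤k k≤total → reaches k 1≤k (≤-trans k≤total (≤-reflexive total-f))) ,
  trans total-f (doubling (2 ^ p) T)
  where
  open Construction G g g-IC p
  1≤T : 1 ≤ T
  1≤T = total-positive G g G-conn g-pos
  doubling : ∀ x T → 1 + x * T + x * T ≡ 2 * x * T + 1
  doubling = solve-∀
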